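{- Let $\mathbf D=\mathbf D_{\underline d,\underline c}$ be a dual hyperoval in $V=F\oplus F$ as described in the context, and $Y=0\oplus F$. If $\Phi\in\mathrm{Aut}(\mathbf D)$ acts as the identity on $Y$ and induces the identity on $V/Y$, then $\Phi=\mathbf 1$.
   Context: $F=\mathbb F_{2^n}$, $n>1$ odd; $\mathrm{Tr}$ absolute trace, $\mathrm{Tr}_{d:e}$ relative trace. $\underline d=(d_0=1,d_1,\dots,d_m)$ are distinct integers with $d_1\mid\cdots\mid d_m\mid n$, $d_m<n$, $F_i=\mathbb F_{2^{d_i}}$; $\underline c=(c_1,\dots,c_m)$ with $c_j\in F_j$, some $c_j\neq0$, and $\sum_{i\le j}c_i\neq1$ for $1\le j\le m$. Operators act on the right: $xE^{(i)}_{a,b}=\mathrm{Tr}_{n:d_i}(ax)b$, $C(a)=(1+\sum_i c_i)a^2\mathbf 1+\sum_i c_iE^{(i)}_{a,a}$, $B(a)=C(a)+E^{(0)}_{a,a}$. $V$ has quadratic form $Q(x,y)=\mathrm{Tr}(xy)$ and $\mathbf D_{\underline d,\underline c}=\{V(a)\mid a\in F\}$ with $V(a)=\{(x,xB(a))\mid x\in F\}$. $\mathrm{Aut}(\mathbf D)$ is the group of elements of $\mathrm{GL}_{\mathbb F_2}(V)$ mapping $\mathbf D$ onto itself. -}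

module Defs where

open import Level using (0ℓ)
open import Data.Nat as ℕ using (ℕ; zero; suc; _≤_; _<_)
open import Data.Nat.Divisibility using (_∣_; _∣?_)
open import Data.Fin using (Fin)
open import Data.Product using (Σ; ∃; ∃-syntax; _×_; _,_; proj₁; proj₂)
open import Function.Bundles using (_↔_)
open import Function.Definitions using (Injective; Surjective)
open import Relation.Nullary using (¬_; does)
open import Data.Bool using (if_then_else_)
open import Relation.Binary.PropositionalEquality using (_≡_; _≢_)
open import Algebra.Structures using (IsCommutativeRing)

-- A finite field with 2^n elements (unique up to isomorphism, so this is
-- "F = GF(2^n)"): a commutative ring (with propositional equality) of
-- characteristic 2, in which every nonzero element is invertible, and
-- whose carrier is in bijection with Fin (2^n).
record GF2^ (n : ℕ) : Set₁ where
  infixl 6 _+_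
  infixl 7 _*_
  field
    Carrier : Set
    _+_ _*_ : Carrier → Carrier → Carrier
    -_ : Carrier → Carrier
    0# 1# : Carrier
    isCommutativeRing : IsCommutativeRing _≡_ _+_ _*_ -_ 0# 1#
    char2 : 1# + 1# ≡ 0#
    inverse : ∀ x → x ≢ 0# → ∃[ y ] (x * y ≡ 1#)
    finite : Carrier ↔ Fin (2 ℕ.^ n)

module FieldDefs {n : ℕ} (𝔽 : GF2^ n) where
  open GF2^ 𝔽

  pow : Carrier → ℕ → Carrier
  pow x zero = 1#
  pow x (suc k) = x * pow x k

  Σ< : ℕ → (ℕ → Carrier) → Carrier
  Σ< zero f = 0#
  Σ< (suc N) f = Σ< N f + f N

  Σ1to : ℕ → (ℕ → Carrier) → Carrier
  Σ1to zero f = 0#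
  Σ1to (suc j) f = Σ1to j f + f (suc j)

  InSubfield : ℕ → Carrier → Set
  InSubfield d x = pow x (2 ℕ.^ d) ≡ x

  -- relative trace Tr_{n:d}(x) = Σ_{j < n/d} x^(2^(d j))
  --   written as Σ_{k < n, d ∣ k} x^(2^k)  (same thing when d ∣ n, d ≥ 1)
  relTr : ℕ → Carrier → Carrier
  relTr d x = Σ< n (λ k → if does (d ∣? k) then pow x (2 ℕ.^ k) else 0#)

  Tr : Carrier → Carrier
  Tr = relTr 1

  E : (d : ℕ → ℕ) → ℕ → Carrier → Carrier → Carrier → Carrier
  E d i a b x = relTr (d i) (a * x) * b

  Cop : (m : ℕ) (d : ℕ → ℕ) (c : ℕ → Carrier) → Carrier → Carrier → Carrier
  Cop m d c a x =
    (1# + Σ1to m c) * (a * a) * x + Σ1to m (λ i → c i * E d i a a x)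

  Bop : (m : ℕ) (d : ℕ → ℕ) (c : ℕ → Carrier) → Carrier → Carrier → Carrier
  Bop m d c a x = Cop m d c a x + E d 0 a a x

  V : Set
  V = Carrier × Carrier

  _⊕_ : V → V → V
  (x , y) ⊕ (x' , y') = (x + x' , y + y')

  MapsOnto : (m : ℕ) (d : ℕ → ℕ) (c : ℕ → Carrier) → (V → V) → Carrier → Carrier → Set
  MapsOnto m d c Φ a b =
    (∀ x → ∃[ y ] (Φ (x , Bop m d c a x) ≡ (y , Bop m d c b y)))
    × (∀ y → ∃[ x ] (Φ (x , Bop m d c a x) ≡ (y , Bop m d c b y)))

  -- Φ ∈ Aut(D): Φ ∈ GL_{F_2}(V) (additive bijection; over F_2 additive = linear)
  -- and Φ maps the set D = {V(a) | a ∈ F} onto itself.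
  IsAut : (m : ℕ) (d : ℕ → ℕ) (c : ℕ → Carrier) → (V → V) → Set
  IsAut m d c Φ =
    (∀ u v → Φ (u ⊕ v) ≡ Φ u ⊕ Φ v)
    × Injective _≡_ _≡_ Φ
    × Surjective _≡_ _≡_ Φ
    × (∀ a → ∃[ b ] MapsOnto m d c Φ a b)
    × (∀ b → ∃[ a ] MapsOnto m d c Φ a b)

  record Params (m : ℕ) (d : ℕ → ℕ) (c : ℕ → Carrier) : Set where
    field
      d0≡1 : d 0 ≡ 1
      distinct : ∀ i j → i ≤ m → j ≤ m → i ≢ j → d i ≢ d j
      chain : ∀ j → 1 ≤ j → j < m → d j ∣ d (suc j)
      dm∣n : d m ∣ n
      dm<n : d m < n
      c∈F : ∀ j → 1 ≤ j → j ≤ m → InSubfield (d j) (c j)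
      someNonzero : ∃[ j ] (1 ≤ j × j ≤ m × c j ≢ 0#)
      partialSums : ∀ j → 1 ≤ j → j ≤ m → Σ1to j c ≢ 1#

-- Additivity, Φ|Y = 1 and Φ = 1 on V/Y make Φ a shear (x, y) ↦ (x, x B(b) + y), where
-- V(0) ↦ V(b); then V(a) ↦ V(s) forces B(b) + B(a) = B(s) for every a. Each x ↦ x B(a) is a
-- linearised polynomial Σ_{k<n} βₖ(a) x^(2^k) of degree < 2^n = |F|, so its coefficients are
-- determined by the map, and as no dᵢ (i ≥ 1) divides 1 or 2, β₁(a) = a³ and β₂(a) = a⁵.
-- So for every a some s has a³ + b³ = s³ and a⁵ + b⁵ = s⁵. With a = b t, (a³ + b³)⁵ = (a⁵ + b⁵)³
-- says b¹⁵ (t³ + t⁵ + t¹⁰ + t¹²) = 0 for all t, impossible for b ≠ 0 since |F| ≥ 16.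
-- Hence b = 0 and Φ = 1.

module Submission where

open import Defs
open import Algebra.Bundles using (CommutativeRing; RawRing)
open import Algebra.Solver.Ring.AlmostCommutativeRing
  using (fromCommutativeSemiring; _-Raw-AlmostCommutative⟶_)
open import Data.Bool using (Bool; true; false; if_then_else_; _xor_; _∧_)
import Data.Fin as Fin
open import Data.List using (List; []; _∷_; length; applyUpTo; tabulate)
open import Data.List.Properties using (length-applyUpTo; length-tabulate)
open import Data.List.Relation.Unary.All as All using (All; []; _∷_)
import Data.List.Relation.Unary.All.Properties as Allₚ
open import Data.List.Relation.Unary.Unique.Propositional using (Unique; _∷_)
import Data.List.Relation.Unary.Unique.Propositional.Properties as Unique
open import Data.Maybe using (Maybe; just; nothing)
open import Data.Nat as ℕ using (ℕ; zero; suc; _<_; _≤_; z≤n; s≤s; _≟_; _^_)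
import Data.Nat.Properties as ℕ
open import Data.Nat.Divisibility using (_∣_; _∣?_; 1∣_; ∣1⇒≡1; 0∣⇒≡0; ∣⇒≤; ∣-trans; ∣-refl; ∣-reflexive)
open import Data.Product using (_,_; proj₁; proj₂; _×_; ∃-syntax)
open import Function.Bundles using (Inverse; Injection)
open import Function.Properties.Inverse using (↔-sym; ↔⇒↣)
open import Relation.Nullary.Decidable using (via-injection; decidable-stable)
open import Relation.Nullary using (¬_; Dec; yes; no; does; contradiction)
open import Relation.Binary.PropositionalEquality
open import Relation.Binary.Definitions using (tri<; tri≈; tri>)

divisor-of-odd-∤2 : ∀ {e n} → ¬ 2 ∣ n → e ∣ n → e ≢ 1 → ¬ e ∣ 2
divisor-of-odd-∤2 {zero} _ _ _ 0∣2 with 0∣⇒≡0 0∣2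
... | ()
divisor-of-odd-∤2 {1} _ _ e≢1 _ = e≢1 refl
divisor-of-odd-∤2 {2} 2∤n 2∣n _ _ = 2∤n 2∣n
divisor-of-odd-∤2 {suc (suc (suc e))} _ _ _ e∣2 with ∣⇒≤ e∣2
... | s≤s (s≤s ())

odd-with-proper-divisor⇒4≤ : ∀ {e n} → ¬ 2 ∣ n → e ∣ n → e < n → e ≢ 1 → 4 ≤ n
odd-with-proper-divisor⇒4≤ {n = 2} 2∤2 _ _ _ = contradiction ∣-refl 2∤2
odd-with-proper-divisor⇒4≤ {zero} {n = suc n} _ 0∣n _ _ with 0∣⇒≡0 0∣n
... | ()
odd-with-proper-divisor⇒4≤ {1} _ _ _ e≢1 = contradiction refl e≢1
odd-with-proper-divisor⇒4≤ {2} {n = 3} 2∤3 2∣3 _ _ = contradiction 2∣3 2∤3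
odd-with-proper-divisor⇒4≤ {suc (suc e)} {n = 1} _ _ (s≤s ()) _
odd-with-proper-divisor⇒4≤ {suc (suc (suc e))} {n = 3} _ _ (s≤s (s≤s (s≤s ()))) _
odd-with-proper-divisor⇒4≤ {suc (suc e)} {n = suc (suc (suc (suc n)))} _ _ _ _ = s≤s (s≤s (s≤s (s≤s z≤n)))

2^-monoʳ-< : ∀ {j k} → j < k → 2 ^ j < 2 ^ k
2^-monoʳ-< = ℕ.^-monoʳ-< 2 (s≤s (s≤s z≤n))

2^-injective : ∀ {j k} → 2 ^ j ≡ 2 ^ k → j ≡ k
2^-injective {j} {k} 2ʲ≡2ᵏ with ℕ.<-cmp j k
... | tri< j<k _ _ = contradiction 2ʲ≡2ᵏ (ℕ.<⇒≢ (2^-monoʳ-< j<k))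
... | tri≈ _ j≡k _ = j≡k
... | tri> _ _ k<j = contradiction (sym 2ʲ≡2ᵏ) (ℕ.<⇒≢ (2^-monoʳ-< k<j))

module Field {n : ℕ} (𝔽 : GF2^ n) where
  open GF2^ 𝔽
  open FieldDefs 𝔽

  commutativeRing : CommutativeRing _ _
  commutativeRing = record { isCommutativeRing = isCommutativeRing }

  open CommutativeRing commutativeRing
    using (zeroˡ; zeroʳ; +-identityˡ; +-identityʳ; *-identityˡ; *-identityʳ; distribʳ; distribˡ; +-assoc; +-comm; *-comm)

  -- Normalising with coefficients in 𝔽₂ lets the ring solver use 1 + 1 = 0.
  module Char2Solver where
    𝔽₂ : RawRing _ _
    𝔽₂ = record { Carrier = Bool; _≈_ = _≡_; _+_ = _xor_; _*_ = _∧_; -_ = λ b → b; 0# = false; 1# = true }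

    embed : Bool → Carrier
    embed true = 1#
    embed false = 0#

    embed-+ : ∀ a b → embed (a xor b) ≡ embed a + embed b
    embed-+ true true = sym char2
    embed-+ true false = sym (+-identityʳ 1#)
    embed-+ false b = sym (+-identityˡ (embed b))

    embed-* : ∀ a b → embed (a ∧ b) ≡ embed a * embed b
    embed-* true b = sym (*-identityˡ (embed b))
    embed-* false b = sym (zeroˡ (embed b))

    morphism : 𝔽₂ -Raw-AlmostCommutative⟶ fromCommutativeSemiring (CommutativeRing.commutativeSemiring commutativeRing)
    morphism = record
      { ⟦_⟧ = embed ; +-homo = embed-+ ; *-homo = embed-* ; -‿homo = λ _ → refl ; 0-homo = refl ; 1-homo = refl }

    embed-≟ : ∀ a b → Maybe (embed a ≡ embed b)
    embed-≟ true true = just refl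
    embed-≟ false false = just refl
    embed-≟ _ _ = nothing

    open import Algebra.Solver.Ring 𝔽₂ _ morphism embed-≟ public

  open Char2Solver using (solve; _:=_; _:+_; _:*_; _:^_; con)

  x+x≡0 : ∀ x → x + x ≡ 0#
  x+x≡0 = solve 1 (λ x → x :+ x := con false) refl

  x+y≡0⇒x≡y : ∀ {x y} → x + y ≡ 0# → x ≡ y
  x+y≡0⇒x≡y {x} {y} x+y≡0 = begin
    x            ≡⟨ solve 2 (λ x y → x := x :+ y :+ y) refl x y ⟩
    x + y + y    ≡⟨ cong (_+ y) x+y≡0 ⟩
    0# + y       ≡⟨ +-identityˡ y ⟩
    y            ∎
    where open ≡-Reasoning

  x*y≡0⇒y≡0 : ∀ {x y} → x ≢ 0# → x * y ≡ 0# → y ≡ 0#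
  x*y≡0⇒y≡0 {x} {y} x≢0 xy≡0 with inverse x x≢0
  ... | x⁻¹ , xx⁻¹≡1 = begin
    y              ≡⟨ sym (*-identityˡ y) ⟩
    1# * y         ≡⟨ cong (_* y) (sym xx⁻¹≡1) ⟩
    x * x⁻¹ * y    ≡⟨ solve 3 (λ x x⁻¹ y → x :* x⁻¹ :* y := x⁻¹ :* (x :* y)) refl x x⁻¹ y ⟩
    x⁻¹ * (x * y)  ≡⟨ cong (x⁻¹ *_) xy≡0 ⟩
    x⁻¹ * 0#       ≡⟨ zeroʳ x⁻¹ ⟩
    0#             ∎
    where open ≡-Reasoning

  1≡0⇒x≡0 : 1# ≡ 0# → ∀ x → x ≡ 0#
  1≡0⇒x≡0 1≡0 x = trans (sym (*-identityʳ x)) (trans (cong (x *_) 1≡0) (zeroʳ x))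

  pow-nonzero : ∀ {x} k → x ≢ 0# → pow x k ≢ 0#
  pow-nonzero {x} zero x≢0 1≡0 = x≢0 (1≡0⇒x≡0 1≡0 x)
  pow-nonzero (suc k) x≢0 xxᵏ≡0 = pow-nonzero k x≢0 (x*y≡0⇒y≡0 x≢0 xxᵏ≡0)

  pow-* : ∀ x y k → pow (x * y) k ≡ pow x k * pow y k
  pow-* x y zero = sym (*-identityˡ 1#)
  pow-* x y (suc k) = trans (cong (x * y *_) (pow-* x y k))
    (solve 4 (λ x y X Y → x :* y :* (X :* Y) := (x :* X) :* (y :* Y)) refl x y (pow x k) (pow y k))

  _≟F_ : (x y : Carrier) → Dec (x ≡ y)
  _≟F_ = via-injection (↔⇒↣ finite) Fin._≟_

  if-yes : ∀ {P : Set} (p? : Dec P) u → P → (if does p? then u else 0#) ≡ u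
  if-yes (yes _) u _ = refl
  if-yes (no ¬p) u p = contradiction p ¬p

  if-no : ∀ {P : Set} (p? : Dec P) u → ¬ P → (if does p? then u else 0#) ≡ 0#
  if-no (yes p) u ¬p = contradiction p ¬p
  if-no (no _) u _ = refl

  if-*ʳ : ∀ {P : Set} (p? : Dec P) u v → (if does p? then u else 0#) * v ≡ (if does p? then u * v else 0#)
  if-*ʳ (yes _) u v = refl
  if-*ʳ (no _) u v = zeroˡ v

  Σ<-cong : ∀ N {f g : ℕ → Carrier} → (∀ k → k < N → f k ≡ g k) → Σ< N f ≡ Σ< N g
  Σ<-cong zero f≗g = refl
  Σ<-cong (suc N) f≗g = cong₂ _+_ (Σ<-cong N (λ k k<N → f≗g k (ℕ.m<n⇒m<1+n k<N))) (f≗g N (ℕ.n<1+n N))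

  Σ<-zero : ∀ N {f : ℕ → Carrier} → (∀ k → k < N → f k ≡ 0#) → Σ< N f ≡ 0#
  Σ<-zero zero f≗0 = refl
  Σ<-zero (suc N) {f} f≗0 = begin
    Σ< N f + f N ≡⟨ cong₂ _+_ (Σ<-zero N (λ k k<N → f≗0 k (ℕ.m<n⇒m<1+n k<N))) (f≗0 N (ℕ.n<1+n N)) ⟩
    0# + 0#      ≡⟨ +-identityʳ 0# ⟩
    0#           ∎
    where open ≡-Reasoning

  Σ<-single : ∀ N {f : ℕ → Carrier} j → j < N → (∀ k → k < N → k ≢ j → f k ≡ 0#) → Σ< N f ≡ f j
  Σ<-single (suc N) {f} j j<1+N f≗0 with N ≟ j
  ... | yes refl = trans (cong (_+ f N) (Σ<-zero N (λ k k<N → f≗0 k (ℕ.m<n⇒m<1+n k<N) (ℕ.<⇒≢ k<N))))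
                         (+-identityˡ (f N))
  ... | no N≢j = trans (cong₂ _+_ (Σ<-single N j j<N (λ k k<N → f≗0 k (ℕ.m<n⇒m<1+n k<N)))
                                  (f≗0 N (ℕ.n<1+n N) N≢j))
                       (+-identityʳ (f j))
    where
      j<N : j < N
      j<N = ℕ.≤∧≢⇒< (ℕ.s≤s⁻¹ j<1+N) (λ j≡N → N≢j (sym j≡N))

  Σ<-+ : ∀ N (f g : ℕ → Carrier) → Σ< N (λ k → f k + g k) ≡ Σ< N f + Σ< N g
  Σ<-+ zero f g = sym (+-identityʳ 0#)
  Σ<-+ (suc N) f g = trans (cong (_+ (f N + g N)) (Σ<-+ N f g))
    (solve 4 (λ F G u v → (F :+ G) :+ (u :+ v) := (F :+ u) :+ (G :+ v)) refl (Σ< N f) (Σ< N g) (f N) (g N))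

  Σ<-*ʳ : ∀ N (f : ℕ → Carrier) y → Σ< N f * y ≡ Σ< N (λ k → f k * y)
  Σ<-*ʳ zero f y = zeroˡ y
  Σ<-*ʳ (suc N) f y = trans (distribʳ y (Σ< N f) (f N)) (cong (_+ (f N * y)) (Σ<-*ʳ N f y))

  Σ<-*ˡ : ∀ N (f : ℕ → Carrier) y → y * Σ< N f ≡ Σ< N (λ k → y * f k)
  Σ<-*ˡ zero f y = zeroʳ y
  Σ<-*ˡ (suc N) f y = trans (distribˡ y (Σ< N f) (f N)) (cong (_+ (y * f N)) (Σ<-*ˡ N f y))

  Σ<-comm : ∀ M N (g : ℕ → ℕ → Carrier) → Σ< M (λ i → Σ< N (g i)) ≡ Σ< N (λ k → Σ< M (λ i → g i k))
  Σ<-comm zero N g = sym (Σ<-zero N (λ _ _ → refl))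
  Σ<-comm (suc M) N g = trans (cong (_+ Σ< N (g M)) (Σ<-comm M N g))
    (sym (Σ<-+ N (λ k → Σ< M (λ i → g i k)) (g M)))

  Σ<-suc : ∀ N (f : ℕ → Carrier) → Σ< (suc N) f ≡ f 0 + Σ< N (λ k → f (suc k))
  Σ<-suc zero f = trans (+-identityˡ (f 0)) (sym (+-identityʳ (f 0)))
  Σ<-suc (suc N) f = trans (cong (_+ f (suc N)) (Σ<-suc N f)) (+-assoc (f 0) _ _)

  Σ1to≡Σ< : ∀ j (f : ℕ → Carrier) → Σ1to j f ≡ Σ< j (λ i → f (suc i))
  Σ1to≡Σ< zero f = refl
  Σ1to≡Σ< (suc j) f = cong (_+ f (suc j)) (Σ1to≡Σ< j f)

  -- A polynomial is its list of coefficients, constant term first.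
  eval : List Carrier → Carrier → Carrier
  eval [] x = 0#
  eval (c ∷ cs) x = c + x * eval cs x

  IsZero : List Carrier → Set
  IsZero = All (_≡ 0#)

  eval-zero : ∀ {p} → IsZero p → ∀ x → eval p x ≡ 0#
  eval-zero [] x = refl
  eval-zero (c≡0 ∷ cs≡0) x = trans (cong₂ (λ c v → c + x * v) c≡0 (eval-zero cs≡0 x))
    (solve 1 (λ x → con false :+ x :* con false := con false) refl x)

  eval-const : ∀ c {cs} → IsZero cs → ∀ x → eval (c ∷ cs) x ≡ c
  eval-const c cs≡0 x = trans (cong (λ v → c + x * v) (eval-zero cs≡0 x))
    (solve 2 (λ c x → c :+ x :* con false := c) refl c x)

  -- quotient r cs lists the coefficients of (p(x) - p(r)) / (x - r) for p = c ∷ cs.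
  quotient : Carrier → List Carrier → List Carrier
  quotient r [] = []
  quotient r (c ∷ cs) = eval (c ∷ cs) r ∷ quotient r cs

  length-quotient : ∀ r cs → length (quotient r cs) ≡ length cs
  length-quotient r [] = refl
  length-quotient r (c ∷ cs) = cong suc (length-quotient r cs)

  eval-quotient : ∀ r c cs x → eval (c ∷ cs) x ≡ eval (c ∷ cs) r + (x + r) * eval (quotient r cs) x
  eval-quotient r c [] x = solve 3 (λ c x r → c :+ x :* con false := (c :+ r :* con false) :+ (x :+ r) :* con false) refl c x r
  eval-quotient r c (c′ ∷ cs) x = trans (cong (λ v → c + x * v) (eval-quotient r c′ cs x))
    (solve 5 (λ c x r P Q → c :+ x :* (P :+ (x :+ r) :* Q) := (c :+ r :* P) :+ (x :+ r) :* (P :+ x :* Q)) refl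
      c x r (eval (c′ ∷ cs) r) (eval (quotient r cs) x))

  quotient-zero⇒zero : ∀ r cs → IsZero (quotient r cs) → IsZero cs
  quotient-zero⇒zero r [] [] = []
  quotient-zero⇒zero r (c ∷ cs) (p[r]≡0 ∷ q≡0) = trans (sym (eval-const c cs≡0 r)) p[r]≡0 ∷ cs≡0
    where
      cs≡0 : IsZero cs
      cs≡0 = quotient-zero⇒zero r cs q≡0

  roots⇒zero : ∀ p rs → Unique rs → length p ≤ length rs → All (λ r → eval p r ≡ 0#) rs → IsZero p
  roots⇒zero [] rs _ _ _ = []
  roots⇒zero (c ∷ cs) (r ∷ rs) (r∉rs ∷ rs-unique) (s≤s |cs|≤|rs|) (p[r]≡0 ∷ p[rs]≡0) =
    trans (sym (eval-const c cs≡0 r)) p[r]≡0 ∷ cs≡0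
    where
      q : List Carrier
      q = quotient r cs

      q[x]≡0 : ∀ {x} → r ≢ x → eval (c ∷ cs) x ≡ 0# → eval q x ≡ 0#
      q[x]≡0 {x} r≢x p[x]≡0 = x*y≡0⇒y≡0 (λ x+r≡0 → r≢x (sym (x+y≡0⇒x≡y x+r≡0))) (begin
        (x + r) * eval q x                    ≡⟨ sym (+-identityˡ _) ⟩
        0# + (x + r) * eval q x               ≡⟨ cong (_+ (x + r) * eval q x) (sym p[r]≡0) ⟩
        eval (c ∷ cs) r + (x + r) * eval q x  ≡⟨ sym (eval-quotient r c cs x) ⟩
        eval (c ∷ cs) x                       ≡⟨ p[x]≡0 ⟩
        0#                                    ∎)
        where open ≡-Reasoning

      cs≡0 : IsZero cs
      cs≡0 = quotient-zero⇒zero r cs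
        (roots⇒zero q rs rs-unique (subst (_≤ length rs) (sym (length-quotient r cs)) |cs|≤|rs|)
          (All.zipWith (λ (r≢x , p[x]≡0) → q[x]≡0 r≢x p[x]≡0) (r∉rs , p[rs]≡0)))

  elements : List Carrier
  elements = tabulate (Inverse.from finite)

  vanishing⇒zero : ∀ p → length p ≤ 2 ^ n → (∀ x → eval p x ≡ 0#) → IsZero p
  vanishing⇒zero p |p|≤2ⁿ p≡0 = roots⇒zero p elements
    (Unique.tabulate⁺ (Injection.injective (↔⇒↣ (↔-sym finite))))
    (subst (length p ≤_) (sym (length-tabulate _)) |p|≤2ⁿ)
    (Allₚ.tabulate⁺ (λ i → p≡0 _))

  eval-applyUpTo : ∀ N f x → eval (applyUpTo f N) x ≡ Σ< N (λ e → f e * pow x e)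
  eval-applyUpTo zero f x = refl
  eval-applyUpTo (suc N) f x = begin
    f 0 + x * eval (applyUpTo (λ e → f (suc e)) N) x
      ≡⟨ cong (λ v → f 0 + x * v) (eval-applyUpTo N (λ e → f (suc e)) x) ⟩
    f 0 + x * Σ< N (λ e → f (suc e) * pow x e)
      ≡⟨ cong (f 0 +_) (Σ<-*ˡ N _ x) ⟩
    f 0 + Σ< N (λ e → x * (f (suc e) * pow x e))
      ≡⟨ cong₂ _+_ (sym (*-identityʳ (f 0)))
           (Σ<-cong N (λ e _ → solve 3 (λ x F P → x :* (F :* P) := F :* (x :* P)) refl x (f (suc e)) (pow x e))) ⟩
    f 0 * 1# + Σ< N (λ e → f (suc e) * pow x (suc e))
      ≡⟨ sym (Σ<-suc N (λ e → f e * pow x e)) ⟩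
    Σ< (suc N) (λ e → f e * pow x e) ∎
    where open ≡-Reasoning

  linearised-vanishing⇒zero : ∀ (g : ℕ → Carrier) → (∀ x → Σ< n (λ k → g k * pow x (2 ^ k)) ≡ 0#) →
                              ∀ k → k < n → g k ≡ 0#
  linearised-vanishing⇒zero g g≡0 k k<n = begin
    g k            ≡⟨ sym coeff-2ᵏ ⟩
    coeff (2 ^ k)  ≡⟨ Allₚ.applyUpTo⁻ coeff (2 ^ n) coeffs≡0 (2^-monoʳ-< k<n) ⟩
    0#             ∎
    where
      open ≡-Reasoning

      coeff : ℕ → Carrier
      coeff e = Σ< n (λ j → if does (e ≟ 2 ^ j) then g j else 0#)

      coeff-2ᵏ : coeff (2 ^ k) ≡ g k
      coeff-2ᵏ = trans (Σ<-single n k k<n (λ j _ k≢j → if-no (2 ^ k ≟ 2 ^ j) (g j) (λ 2ᵏ≡2ʲ → k≢j (sym (2^-injective 2ᵏ≡2ʲ)))))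
                       (if-yes (2 ^ k ≟ 2 ^ k) (g k) refl)

      eval-coeffs : ∀ x → eval (applyUpTo coeff (2 ^ n)) x ≡ Σ< n (λ j → g j * pow x (2 ^ j))
      eval-coeffs x = begin
        eval (applyUpTo coeff (2 ^ n)) x
          ≡⟨ eval-applyUpTo (2 ^ n) coeff x ⟩
        Σ< (2 ^ n) (λ e → coeff e * pow x e)
          ≡⟨ Σ<-cong (2 ^ n) (λ e _ → trans (Σ<-*ʳ n _ (pow x e)) (Σ<-cong n (λ j _ → if-*ʳ (e ≟ 2 ^ j) _ _))) ⟩
        Σ< (2 ^ n) (λ e → Σ< n (λ j → if does (e ≟ 2 ^ j) then g j * pow x e else 0#))
          ≡⟨ Σ<-comm (2 ^ n) n _ ⟩
        Σ< n (λ j → Σ< (2 ^ n) (λ e → if does (e ≟ 2 ^ j) then g j * pow x e else 0#))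
          ≡⟨ Σ<-cong n (λ j j<n → trans (Σ<-single (2 ^ n) (2 ^ j) (2^-monoʳ-< j<n) (λ e _ → if-no (e ≟ 2 ^ j) _))
                                        (if-yes (2 ^ j ≟ 2 ^ j) _ refl)) ⟩
        Σ< n (λ j → g j * pow x (2 ^ j)) ∎

      coeffs≡0 : IsZero (applyUpTo coeff (2 ^ n))
      coeffs≡0 = vanishing⇒zero _ (ℕ.≤-reflexive (length-applyUpTo coeff (2 ^ n)))
                   (λ x → trans (eval-coeffs x) (g≡0 x))

  cube-and-fifth-sums⇒zero : 4 ≤ n → ∀ b →
    (∀ a → ∃[ s ] (pow a 3 + pow b 3 ≡ pow s 3 × pow a 5 + pow b 5 ≡ pow s 5)) → b ≡ 0#
  cube-and-fifth-sums⇒zero 4≤n b sums = decidable-stable (b ≟F 0#) b≢0-absurd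
    where
      P : List Carrier
      P = 0# ∷ 0# ∷ 0# ∷ 1# ∷ 0# ∷ 1# ∷ 0# ∷ 0# ∷ 0# ∷ 0# ∷ 1# ∷ 0# ∷ 1# ∷ []

      13≤2ⁿ : 13 ≤ 2 ^ n
      13≤2ⁿ = ℕ.≤-trans (ℕ.m≤m+n 13 3) (ℕ.^-monoʳ-≤ 2 4≤n)

      eval-P : ∀ t → eval P t ≡ pow t 3 + pow t 5 + pow t 10 + pow t 12
      eval-P = solve 1 (λ t → con false :+ t :* (con false :+ t :* (con false :+ t :* (con true :+ t :* (con false
                 :+ t :* (con true :+ t :* (con false :+ t :* (con false :+ t :* (con false :+ t :* (con false
                 :+ t :* (con true :+ t :* (con false :+ t :* (con true :+ t :* con false))))))))))))
               := t :^ 3 :+ t :^ 5 :+ t :^ 10 :+ t :^ 12) refl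

      P[t]≡0 : b ≢ 0# → ∀ t → eval P t ≡ 0#
      P[t]≡0 b≢0 t with sums (b * t)
      ... | s , cubes , fifths = x*y≡0⇒y≡0 (pow-nonzero 15 b≢0) (begin
        pow b 15 * eval P t
          ≡⟨ cong (pow b 15 *_) (eval-P t) ⟩
        pow b 15 * (pow t 3 + pow t 5 + pow t 10 + pow t 12)
          ≡⟨ solve 2 (λ b t → b :^ 15 :* (t :^ 3 :+ t :^ 5 :+ t :^ 10 :+ t :^ 12)
                := ((b :* t) :^ 3 :+ b :^ 3) :^ 5 :+ ((b :* t) :^ 5 :+ b :^ 5) :^ 3) refl b t ⟩
        pow (pow (b * t) 3 + pow b 3) 5 + pow (pow (b * t) 5 + pow b 5) 3
          ≡⟨ cong₂ (λ u v → pow u 5 + pow v 3) cubes fifths ⟩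
        pow (pow s 3) 5 + pow (pow s 5) 3
          ≡⟨ solve 1 (λ s → (s :^ 3) :^ 5 :+ (s :^ 5) :^ 3 := con false) refl s ⟩
        0# ∎)
        where open ≡-Reasoning

      b≢0-absurd : ¬ b ≢ 0#
      b≢0-absurd b≢0 = b≢0 (1≡0⇒x≡0 1≡0 b)
        where
          1≡0 : 1# ≡ 0#
          1≡0 = All.head (Allₚ.drop⁺ 3 (vanishing⇒zero P 13≤2ⁿ (P[t]≡0 b≢0)))

  𝟙∣ : ℕ → ℕ → Carrier
  𝟙∣ e k = if does (e ∣? k) then 1# else 0#

  linear-term-linearised : 0 < n → ∀ y x →
    y * x ≡ Σ< n (λ k → (if does (k ≟ 0) then y else 0#) * pow x (2 ^ k))
  linear-term-linearised 0<n y x = sym (begin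
    Σ< n (λ k → (if does (k ≟ 0) then y else 0#) * pow x (2 ^ k))
      ≡⟨ Σ<-single n 0 0<n (λ k _ k≢0 → trans (cong (_* pow x (2 ^ k)) (if-no (k ≟ 0) y k≢0)) (zeroˡ _)) ⟩
    y * (x * 1#)
      ≡⟨ cong (y *_) (*-identityʳ x) ⟩
    y * x ∎)
    where open ≡-Reasoning

  relTr-linearised : ∀ e a x →
    relTr e (a * x) * a ≡ Σ< n (λ k → 𝟙∣ e k * (pow a (2 ^ k) * a) * pow x (2 ^ k))
  relTr-linearised e a x = trans (Σ<-*ʳ n _ a) (Σ<-cong n (λ k _ → term k))
    where
      term : ∀ k → (if does (e ∣? k) then pow (a * x) (2 ^ k) else 0#) * a ≡ 𝟙∣ e k * (pow a (2 ^ k) * a) * pow x (2 ^ k)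
      term k with e ∣? k
      ... | yes _ = trans (cong (_* a) (pow-* a x (2 ^ k)))
              (solve 3 (λ A X a → A :* X :* a := con true :* (A :* a) :* X) refl (pow a (2 ^ k)) (pow x (2 ^ k)) a)
      ... | no _ = solve 3 (λ A X a → con false :* a := con false :* (A :* a) :* X) refl (pow a (2 ^ k)) (pow x (2 ^ k)) a

  module Linearisation (m : ℕ) (d : ℕ → ℕ) (c : ℕ → Carrier) where
    -- Bcoeff a k is the coefficient of x^(2^k) in x B(a): each cᵢ Tr_{n:dᵢ}(a x) a (with c₀ = 1)
    -- contributes cᵢ a^(2^k) a for dᵢ ∣ k, and the scalar part of C(a) adds (1 + Σ cᵢ) a² at k = 0.
    traceWeight : ℕ → Carrier
    traceWeight k = Σ1to m (λ i → c i * 𝟙∣ (d i) k) + 𝟙∣ (d 0) k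

    Bcoeff : Carrier → ℕ → Carrier
    Bcoeff a k = (if does (k ≟ 0) then (1# + Σ1to m c) * (a * a) else 0#) + traceWeight k * (pow a (2 ^ k) * a)

    Σc-relTr-linearised : ∀ a x → Σ1to m (λ i → c i * E d i a a x)
      ≡ Σ< n (λ k → Σ1to m (λ i → c i * 𝟙∣ (d i) k) * (pow a (2 ^ k) * a * pow x (2 ^ k)))
    Σc-relTr-linearised a x = begin
      Σ1to m (λ i → c i * E d i a a x)
        ≡⟨ Σ1to≡Σ< m _ ⟩
      Σ< m (λ i → c (suc i) * (relTr (d (suc i)) (a * x) * a))
        ≡⟨ Σ<-cong m (λ i _ → trans (cong (c (suc i) *_) (relTr-linearised (d (suc i)) a x)) (Σ<-*ˡ n _ (c (suc i)))) ⟩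
      Σ< m (λ i → Σ< n (λ k → c (suc i) * (𝟙∣ (d (suc i)) k * A k * X k)))
        ≡⟨ Σ<-comm m n _ ⟩
      Σ< n (λ k → Σ< m (λ i → c (suc i) * (𝟙∣ (d (suc i)) k * A k * X k)))
        ≡⟨ Σ<-cong n (λ k _ → trans
             (Σ<-cong m (λ i _ → solve 4 (λ C I A X → C :* (I :* A :* X) := C :* I :* (A :* X)) refl
               (c (suc i)) (𝟙∣ (d (suc i)) k) (A k) (X k)))
             (sym (trans (cong (_* (A k * X k)) (Σ1to≡Σ< m _)) (Σ<-*ʳ m _ (A k * X k))))) ⟩
      Σ< n (λ k → Σ1to m (λ i → c i * 𝟙∣ (d i) k) * (A k * X k)) ∎
      where
        open ≡-Reasoning
        A X : ℕ → Carrier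
        A k = pow a (2 ^ k) * a
        X k = pow x (2 ^ k)

    Bop-linearised : 0 < n → ∀ a x → Bop m d c a x ≡ Σ< n (λ k → Bcoeff a k * pow x (2 ^ k))
    Bop-linearised 0<n a x = begin
      Bop m d c a x
        ≡⟨ cong₂ _+_ (cong₂ _+_ (linear-term-linearised 0<n ((1# + Σ1to m c) * (a * a)) x) (Σc-relTr-linearised a x))
                     (relTr-linearised (d 0) a x) ⟩
      Σ< n f₁ + Σ< n f₂ + Σ< n f₃
        ≡⟨ trans (cong (_+ Σ< n f₃) (sym (Σ<-+ n f₁ f₂))) (sym (Σ<-+ n _ f₃)) ⟩
      Σ< n (λ k → f₁ k + f₂ k + f₃ k)
        ≡⟨ Σ<-cong n (λ k _ → solve 5 (λ D X W A I → D :* X :+ W :* (A :* X) :+ I :* A :* X := (D :+ (W :+ I) :* A) :* X) refl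
             (δ k) (pow x (2 ^ k)) (Σ1to m (λ i → c i * 𝟙∣ (d i) k)) (pow a (2 ^ k) * a) (𝟙∣ (d 0) k)) ⟩
      Σ< n (λ k → Bcoeff a k * pow x (2 ^ k)) ∎
      where
        open ≡-Reasoning
        δ f₁ f₂ f₃ : ℕ → Carrier
        δ k = if does (k ≟ 0) then (1# + Σ1to m c) * (a * a) else 0#
        f₁ k = δ k * pow x (2 ^ k)
        f₂ k = Σ1to m (λ i → c i * 𝟙∣ (d i) k) * (pow a (2 ^ k) * a * pow x (2 ^ k))
        f₃ k = 𝟙∣ (d 0) k * (pow a (2 ^ k) * a) * pow x (2 ^ k)

    Bcoeff-undivided : d 0 ≡ 1 → ∀ {k} → 0 < k → (∀ i → 1 ≤ i → i ≤ m → ¬ d i ∣ k) →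
                       ∀ a → Bcoeff a k ≡ pow a (suc (2 ^ k))
    Bcoeff-undivided d₀≡1 {k} 0<k dᵢ∤k a = begin
      Bcoeff a k
        ≡⟨ cong₂ (λ δ w → δ + w * (pow a (2 ^ k) * a)) (if-no (k ≟ 0) _ (ℕ.>⇒≢ 0<k)) traceWeight≡1 ⟩
      0# + 1# * (pow a (2 ^ k) * a)
        ≡⟨ solve 1 (λ A → con false :+ con true :* A := A) refl _ ⟩
      pow a (2 ^ k) * a
        ≡⟨ *-comm _ a ⟩
      pow a (suc (2 ^ k)) ∎
      where
        open ≡-Reasoning
        traceWeight≡1 : traceWeight k ≡ 1#
        traceWeight≡1 = begin
          traceWeight k
            ≡⟨ cong₂ _+_ (trans (Σ1to≡Σ< m _) (Σ<-zero m (λ i i<m →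
                 trans (cong (c (suc i) *_) (if-no (d (suc i) ∣? k) 1# (dᵢ∤k (suc i) (s≤s z≤n) i<m))) (zeroʳ _))))
                 (if-yes (d 0 ∣? k) 1# (subst (_∣ k) (sym d₀≡1) (1∣ k))) ⟩
          0# + 1#
            ≡⟨ +-identityˡ 1# ⟩
          1# ∎

    Bop-sum⇒Bcoeff-sum : 0 < n → ∀ {a b s} → (∀ x → Bop m d c b x + Bop m d c a x ≡ Bop m d c s x) →
                         ∀ k → k < n → Bcoeff a k + Bcoeff b k ≡ Bcoeff s k
    Bop-sum⇒Bcoeff-sum 0<n {a} {b} {s} sum k k<n =
      x+y≡0⇒x≡y (linearised-vanishing⇒zero (λ k → Bcoeff a k + Bcoeff b k + Bcoeff s k) vanishes k k<n)
      where
        B : Carrier → Carrier → Carrier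
        B = Bop m d c

        vanishes : ∀ x → Σ< n (λ k → (Bcoeff a k + Bcoeff b k + Bcoeff s k) * pow x (2 ^ k)) ≡ 0#
        vanishes x = begin
          Σ< n (λ k → (Bcoeff a k + Bcoeff b k + Bcoeff s k) * pow x (2 ^ k))
            ≡⟨ Σ<-cong n (λ k _ → distribʳ (pow x (2 ^ k)) _ _) ⟩
          Σ< n (λ k → (Bcoeff a k + Bcoeff b k) * pow x (2 ^ k) + Bcoeff s k * pow x (2 ^ k))
            ≡⟨ trans (Σ<-+ n _ _) (cong (_+ _) (trans (Σ<-cong n (λ k _ → distribʳ (pow x (2 ^ k)) _ _)) (Σ<-+ n _ _))) ⟩
          Σ< n (λ k → Bcoeff a k * pow x (2 ^ k)) + Σ< n (λ k → Bcoeff b k * pow x (2 ^ k))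
            + Σ< n (λ k → Bcoeff s k * pow x (2 ^ k))
            ≡⟨ sym (cong₂ _+_ (cong₂ _+_ (Bop-linearised 0<n a x) (Bop-linearised 0<n b x)) (Bop-linearised 0<n s x)) ⟩
          B a x + B b x + B s x
            ≡⟨ cong (_+ B s x) (+-comm (B a x) (B b x)) ⟩
          B b x + B a x + B s x
            ≡⟨ cong (_+ B s x) (sum x) ⟩
          B s x + B s x
            ≡⟨ x+x≡0 (B s x) ⟩
          0# ∎
          where open ≡-Reasoning

    Bop-zero : ∀ x → Bop m d c 0# x ≡ 0#
    Bop-zero x = begin
      (1# + Σ1to m c) * (0# * 0#) * x + Σ1to m (λ i → c i * (relTr (d i) (0# * x) * 0#)) + relTr (d 0) (0# * x) * 0#
        ≡⟨ cong (λ z → (1# + Σ1to m c) * (0# * 0#) * x + z + relTr (d 0) (0# * x) * 0#)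
             (trans (Σ1to≡Σ< m _) (Σ<-zero m (λ i _ → trans (cong (c (suc i) *_) (zeroʳ _)) (zeroʳ _)))) ⟩
      (1# + Σ1to m c) * (0# * 0#) * x + 0# + relTr (d 0) (0# * x) * 0#
        ≡⟨ solve 3 (λ K x R → K :* (con false :* con false) :* x :+ con false :+ R :* con false := con false) refl
             (1# + Σ1to m c) x (relTr (d 0) (0# * x)) ⟩
      0# ∎
      where open ≡-Reasoning

    translation-closed⇒zero : 4 ≤ n → d 0 ≡ 1 →
      (∀ i → 1 ≤ i → i ≤ m → ¬ d i ∣ 1) → (∀ i → 1 ≤ i → i ≤ m → ¬ d i ∣ 2) →
      ∀ b → (∀ a → ∃[ s ] (∀ x → Bop m d c b x + Bop m d c a x ≡ Bop m d c s x)) → b ≡ 0#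
    translation-closed⇒zero 4≤n d₀≡1 dᵢ∤1 dᵢ∤2 b closed = cube-and-fifth-sums⇒zero 4≤n b sums
      where
        power-sum : ∀ {k} → 0 < k → k < n → (∀ i → 1 ≤ i → i ≤ m → ¬ d i ∣ k) →
                    ∀ {a s} → (∀ x → Bop m d c b x + Bop m d c a x ≡ Bop m d c s x) →
                    pow a (suc (2 ^ k)) + pow b (suc (2 ^ k)) ≡ pow s (suc (2 ^ k))
        power-sum {k} 0<k k<n dᵢ∤k {a} {s} sum = begin
          pow a (suc (2 ^ k)) + pow b (suc (2 ^ k))
            ≡⟨ sym (cong₂ _+_ (Bcoeff-undivided d₀≡1 0<k dᵢ∤k a) (Bcoeff-undivided d₀≡1 0<k dᵢ∤k b)) ⟩
          Bcoeff a k + Bcoeff b k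
            ≡⟨ Bop-sum⇒Bcoeff-sum (ℕ.<-≤-trans (s≤s z≤n) 4≤n) sum k k<n ⟩
          Bcoeff s k
            ≡⟨ Bcoeff-undivided d₀≡1 0<k dᵢ∤k s ⟩
          pow s (suc (2 ^ k)) ∎
          where open ≡-Reasoning

        sums : ∀ a → ∃[ s ] (pow a 3 + pow b 3 ≡ pow s 3 × pow a 5 + pow b 5 ≡ pow s 5)
        sums a with closed a
        ... | s , sum = s , power-sum (s≤s z≤n) (ℕ.<-≤-trans (s≤s (s≤s z≤n)) 4≤n) dᵢ∤1 sum
                          , power-sum (s≤s z≤n) (ℕ.<-≤-trans (s≤s (s≤s (s≤s z≤n))) 4≤n) dᵢ∤2 sum

  shear-form : (Φ : V → V) → (∀ u v → Φ (u ⊕ v) ≡ Φ u ⊕ Φ v) → (∀ y → Φ (0# , y) ≡ (0# , y)) →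
               (∀ x y → proj₁ (Φ (x , y)) ≡ x) → ∀ x y → Φ (x , y) ≡ (x , proj₂ (Φ (x , 0#)) + y)
  shear-form Φ additive fixes-Y fixes-V/Y x y = begin
    Φ (x , y)                                       ≡⟨ cong Φ (cong₂ _,_ (sym (+-identityʳ x)) (sym (+-identityˡ y))) ⟩
    Φ ((x , 0#) ⊕ (0# , y))                         ≡⟨ additive (x , 0#) (0# , y) ⟩
    Φ (x , 0#) ⊕ Φ (0# , y)                         ≡⟨ cong (Φ (x , 0#) ⊕_) (fixes-Y y) ⟩
    (proj₁ (Φ (x , 0#)) + 0# , proj₂ (Φ (x , 0#)) + y)  ≡⟨ cong (_, proj₂ (Φ (x , 0#)) + y) (trans (+-identityʳ _) (fixes-V/Y x 0#)) ⟩
    (x , proj₂ (Φ (x , 0#)) + y)                    ∎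
    where open ≡-Reasoning

  graph-image : ∀ m d c Φ a b → (∀ x y → proj₁ (Φ (x , y)) ≡ x) → MapsOnto m d c Φ a b →
                ∀ x → Φ (x , Bop m d c a x) ≡ (x , Bop m d c b x)
  graph-image m d c Φ a b fixes-V/Y (into , _) x with into x
  ... | y , Φ[x,xBa]≡[y,yBb] = trans Φ[x,xBa]≡[y,yBb] (cong (λ z → (z , Bop m d c b z)) y≡x)
    where
      y≡x : y ≡ x
      y≡x = trans (sym (cong proj₁ Φ[x,xBa]≡[y,yBb])) (fixes-V/Y x (Bop m d c a x))

  shear-by-Bop : ∀ m d c Φ → IsAut m d c Φ → (∀ y → Φ (0# , y) ≡ (0# , y)) → (∀ x y → proj₁ (Φ (x , y)) ≡ x) →
    ∃[ b ] ((∀ x y → Φ (x , y) ≡ (x , Bop m d c b x + y))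
           × (∀ a → ∃[ s ] (∀ x → Bop m d c b x + Bop m d c a x ≡ Bop m d c s x)))
  shear-by-Bop m d c Φ (additive , _ , _ , onto , _) fixes-Y fixes-V/Y = b , Φ≡shear , closed
    where
      B : Carrier → Carrier → Carrier
      B = Bop m d c

      b : Carrier
      b = proj₁ (onto 0#)

      Φ[x,0] : ∀ x → Φ (x , 0#) ≡ (x , B b x)
      Φ[x,0] x = subst (λ z → Φ (x , z) ≡ (x , B b x)) (Linearisation.Bop-zero m d c x)
                       (graph-image m d c Φ 0# b fixes-V/Y (proj₂ (onto 0#)) x)

      Φ≡shear : ∀ x y → Φ (x , y) ≡ (x , B b x + y)
      Φ≡shear x y = trans (shear-form Φ additive fixes-Y fixes-V/Y x y) (cong (λ z → (x , proj₂ z + y)) (Φ[x,0] x))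

      closed : ∀ a → ∃[ s ] (∀ x → B b x + B a x ≡ B s x)
      closed a with onto a
      ... | s , V[a]↦V[s] = s , λ x → cong proj₂ (trans (sym (Φ≡shear x (B a x))) (graph-image m d c Φ a s fixes-V/Y V[a]↦V[s] x))

  module Admissible {m d c} (params : Params m d c) (2∤n : ¬ 2 ∣ n) where
    open Params params

    1≤m : 1 ≤ m
    1≤m with someNonzero
    ... | j , 1≤j , j≤m , _ = ℕ.≤-trans 1≤j j≤m

    dᵢ≢1 : ∀ i → 1 ≤ i → i ≤ m → d i ≢ 1
    dᵢ≢1 i 1≤i i≤m dᵢ≡1 = distinct 0 i z≤n i≤m (ℕ.<⇒≢ 1≤i) (trans d0≡1 (sym dᵢ≡1))

    d-chain : ∀ k {i} → 1 ≤ i → i ℕ.+ k ≤ m → d i ∣ d (i ℕ.+ k)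
    d-chain zero {i} _ _ = ∣-reflexive (cong d (sym (ℕ.+-identityʳ i)))
    d-chain (suc k) {i} 1≤i i+1+k≤m = ∣-trans (chain i 1≤i (ℕ.<-≤-trans (ℕ.m<m+n i (s≤s z≤n)) i+1+k≤m))
      (subst (λ j → d (suc i) ∣ d j) (sym (ℕ.+-suc i k)) (d-chain k (s≤s z≤n) (subst (_≤ m) (ℕ.+-suc i k) i+1+k≤m)))

    dᵢ∣n : ∀ i → 1 ≤ i → i ≤ m → d i ∣ n
    dᵢ∣n i 1≤i i≤m = ∣-trans (subst (λ j → d i ∣ d j) (ℕ.m+[n∸m]≡n i≤m) (d-chain (m ℕ.∸ i) 1≤i (ℕ.≤-reflexive (ℕ.m+[n∸m]≡n i≤m)))) dm∣n

    4≤n : 4 ≤ n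
    4≤n = odd-with-proper-divisor⇒4≤ 2∤n dm∣n dm<n (dᵢ≢1 m 1≤m ℕ.≤-refl)

    dᵢ∤1 : ∀ i → 1 ≤ i → i ≤ m → ¬ d i ∣ 1
    dᵢ∤1 i 1≤i i≤m dᵢ∣1 = dᵢ≢1 i 1≤i i≤m (∣1⇒≡1 dᵢ∣1)

    dᵢ∤2 : ∀ i → 1 ≤ i → i ≤ m → ¬ d i ∣ 2
    dᵢ∤2 i 1≤i i≤m = divisor-of-odd-∤2 2∤n (dᵢ∣n i 1≤i i≤m) (dᵢ≢1 i 1≤i i≤m)

lemma5p4 : (n : ℕ) → 1 < n → ¬ (2 ∣ n) → (𝔽 : GF2^ n) →
    let open GF2^ 𝔽 in
    let open FieldDefs 𝔽 in
    (m : ℕ) (d : ℕ → ℕ) (c : ℕ → Carrier) → Params m d c →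
    (Φ : V → V) → IsAut m d c Φ →
    (∀ y → Φ (0# , y) ≡ (0# , y)) →
    (∀ x y → proj₁ (Φ (x , y)) ≡ x) →
    ∀ v → Φ v ≡ v
lemma5p4 n _ 2∤n 𝔽 m d c params Φ aut fixes-Y fixes-V/Y (x , y)
  with Field.shear-by-Bop 𝔽 m d c Φ aut fixes-Y fixes-V/Y
... | b , Φ≡shear , closed = begin
  Φ (x , y)                ≡⟨ Φ≡shear x y ⟩
  (x , Bop m d c b x + y)  ≡⟨ cong (λ z → (x , z + y)) xBb≡0 ⟩
  (x , 0# + y)             ≡⟨ cong (x ,_) (+-identityˡ y) ⟩
  (x , y)                  ∎
  where
    open GF2^ 𝔽
    open FieldDefs 𝔽
    open Field 𝔽
    open CommutativeRing commutativeRing using (+-identityˡ)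
    open Linearisation m d c
    open Admissible params 2∤n
    open ≡-Reasoning

    b≡0 : b ≡ 0#
    b≡0 = translation-closed⇒zero 4≤n (Params.d0≡1 params) dᵢ∤1 dᵢ∤2 b closed

    xBb≡0 : Bop m d c b x ≡ 0#
    xBb≡0 = trans (cong (λ b → Bop m d c b x) b≡0) (Bop-zero x)
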